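{- Let $G$ be a finite abelian group of order $n$, let $x\in G$ and let $k\ge 2$ be an integer such that $\mathcal{B}_k^x\neq\emptyset$. Then $(G,\mathcal{B}_k^x)$ is a $1$-$(n,k,r)$ design if and only if $b_{k-1}^{x-ky,*}=r$ for every $y\in G$, where $r$ is a constant independent of $y$.
   Context: For a finite abelian group $G$ (written additively) of order $n$, $G^*=G\setminus\{0\}$. For $x\in G$ and $1\le k\le n$, $\mathcal{B}_k^x$ denotes the family of all $k$-subsets of $G$ whose elements sum to $x$. For $1\le k\le n-1$, $\mathcal{B}_k^{x,*}$ denotes the family of all $k$-subsets of $G^*$ whose elements sum to $x$, and $b_k^{x,*}=|\mathcal{B}_k^{x,*}|$. A $t$-$(v,k,\lambda)$ design is a pair $(\mathcal{P},\mathcal{B})$ with $|\mathcal{P}|=v$ and $\mathcal{B}$ a family of distinct $k$-subsets of $\mathcal{P}$ (blocks) such that every $t$-subset of $\mathcal{P}$ is contained in exactly $\lambda$ blocks. -}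

module Defs where

open import Data.Nat using (ℕ; zero; suc; _≤_; _∸_)
open import Data.Fin using (Fin)
open import Data.Fin.Subset using (Subset; _∈_; _∉_; ∣_∣; inside; outside)
open import Data.Fin.Subset.Properties using (_∈?_)
open import Data.List using (List; []; _∷_; map; _++_; filter; length; foldr; allFin)
open import Data.List.Relation.Unary.All using (All)
open import Data.List.Relation.Unary.Unique.Propositional using (Unique)
open import Data.Vec using (_∷_; [])
open import Data.Product using (_×_)
open import Relation.Binary.PropositionalEquality using (_≡_)
open import Relation.Nullary using (¬_)
open import Relation.Nullary.Decidable using (_×-dec_; ¬?)
open import Algebra.Structures using (IsAbelianGroup)
import Data.Fin as F

-- A finite abelian group of order n, presented (up to isomorphism) on the
-- carrier Fin n with propositional equality.
record FinAbelianGroup (n : ℕ) : Set where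
  field
    _+_ : Fin n → Fin n → Fin n
    0g  : Fin n
    -_  : Fin n → Fin n
    isAbelianGroup : IsAbelianGroup _≡_ _+_ 0g -_
  infixl 6 _+_
  infix  8 -_

  _-_ : Fin n → Fin n → Fin n
  a - b = a + (- b)

  _·_ : ℕ → Fin n → Fin n
  zero  · y = 0g
  suc k · y = y + (k · y)

  Σ[_] : Subset n → Fin n
  Σ[ s ] = foldr _+_ 0g (filter (_∈? s) (allFin n))

allSubsets : (n : ℕ) → List (Subset n)
allSubsets zero    = [] ∷ []
allSubsets (suc n) = map (outside ∷_) (allSubsets n) ++ map (inside ∷_) (allSubsets n)

module _ {n : ℕ} (G : FinAbelianGroup n) where
  open FinAbelianGroup G

  𝓑 : ℕ → Fin n → List (Subset n)
  𝓑 k x = filter (λ s → (∣ s ∣ Data.Nat.≟ k) ×-dec (Σ[ s ] F.≟ x)) (allSubsets n)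

  𝓑* : ℕ → Fin n → List (Subset n)
  𝓑* k x = filter (λ s → ¬? (0g ∈? s) ×-dec ((∣ s ∣ Data.Nat.≟ k) ×-dec (Σ[ s ] F.≟ x))) (allSubsets n)

  b* : ℕ → Fin n → ℕ
  b* k x = length (𝓑* k x)

Is1Design : (v k r : ℕ) → List (Subset v) → Set
Is1Design v k r blocks =
  Unique blocks × All (λ B → ∣ B ∣ ≡ k) blocks
  × (∀ (p : Fin v) → length (filter (p ∈?_) blocks) ≡ r)

-- For a point y, s ↦ (s − y) ∖ {0} is a bijection from the blocks of 𝓑_k^x through y onto
-- 𝓑_{k−1}^{x−ky,*}, with inverse t ↦ (t ∪ {0}) + y: translating a k-set by −y lowers its sum by
-- ky, and removing or adding 0 leaves the sum unchanged. So y lies in exactly b_{k−1}^{x−ky,*}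
-- blocks. The blocks of 𝓑_k^x are distinct k-sets anyway, so (G, 𝓑_k^x) is a 1-(n,k,r) design
-- exactly when all these numbers equal r.
{-# OPTIONS --safe #-}
module Submission where

open import Defs
open import Data.Nat using (ℕ; _≤_; _∸_)
open import Data.Fin using (Fin)
open import Data.List using (List; [])
open import Relation.Binary.PropositionalEquality using (_≡_; _≢_)
open import Function.Bundles using (_⇔_)

open import Algebra.Bundles using (AbelianGroup)
import Algebra.Properties.AbelianGroup as AbelianGroupProperties
import Algebra.Properties.CommutativeSemigroup as CommutativeSemigroupProperties
open import Data.Bool using (true; false)
open import Data.Fin using (suc; _≟_)
open import Data.Fin.Subset using (Subset; inside; outside; ∣_∣; _∈_; _∉_)
open import Data.Fin.Subset.Properties using (_∈?_)
open import Data.List using (_∷_; map; filter; length; foldr; allFin; tabulate)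
open import Data.List.Membership.Propositional using () renaming (_∈_ to _∈ₗ_)
open import Data.List.Membership.Propositional.Properties
  using (∈-map⁺; ∈-map⁻; ∈-++⁺ˡ; ∈-++⁺ʳ; ∈-filter⁺; ∈-filter⁻; ∈-allFin)
open import Data.List.Membership.Propositional.Properties.WithK using (unique∧set⇒bag)
open import Data.List.Properties using (length-map; map-∘; map-id-local; map-tabulate)
open import Data.List.Relation.Binary.BagAndSetEquality using (∼bag⇒↭)
open import Data.List.Relation.Binary.Permutation.Propositional using (_↭_; ↭⇒↭ₛ)
open import Data.List.Relation.Binary.Permutation.Propositional.Properties using (↭-length)
import Data.List.Relation.Binary.Permutation.Setoid.Properties as PermSetoid
open import Data.List.Relation.Unary.All as All using (All; [])
open import Data.List.Relation.Unary.AllPairs using ([]; _∷_)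
open import Data.List.Relation.Unary.Any using (here; there)
open import Data.List.Relation.Unary.Unique.Propositional using (Unique)
import Data.List.Relation.Unary.Unique.Propositional.Properties as Unique
import Data.Nat as ℕ
open import Data.Nat.Properties using (suc-injective)
open import Data.Product using (_×_; _,_; proj₁; proj₂)
open import Data.Vec using ([]; _∷_; lookup; _[_]≔_)
import Data.Vec as Vec
open import Data.Vec.Properties
  using (∷-injectiveʳ; []=⇒lookup; lookup⇒[]=; []=-injective; lookup∘tabulate; tabulate∘lookup;
         tabulate-cong; lookup∘update′; []≔-updates; []≔-minimal; []≔-idempotent; []≔-lookup)
open import Function using (_∘_; mk⇔)
open import Level using (0ℓ)
open import Relation.Binary.PropositionalEquality
  using (refl; sym; trans; cong; cong₂; subst; setoid; module ≡-Reasoning)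
open import Relation.Nullary using (¬_; yes; no; does; contradiction)

open ≡-Reasoning

module _ {a b} {A : Set a} {B : Set b} {xs : List A} {ys : List B} where

  length-≡-by-inverses : Unique xs → Unique ys → (f : A → B) (g : B → A)
    → (∀ {x} → x ∈ₗ xs → f x ∈ₗ ys) → (∀ {y} → y ∈ₗ ys → g y ∈ₗ xs)
    → (∀ {x} → x ∈ₗ xs → g (f x) ≡ x) → (∀ {y} → y ∈ₗ ys → f (g y) ≡ y)
    → length xs ≡ length ys
  length-≡-by-inverses xs! ys! f g f∈ g∈ gf≡id fg≡id = begin
    length xs          ≡⟨ length-map f xs ⟨
    length (map f xs)  ≡⟨ ↭-length (∼bag⇒↭ (unique∧set⇒bag fxs! ys! (mk⇔ to from))) ⟩
    length ys          ∎
    where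
    gfxs≡xs : map g (map f xs) ≡ xs
    gfxs≡xs = trans (sym (map-∘ xs)) (map-id-local (All.tabulate gf≡id))

    fxs! : Unique (map f xs)
    fxs! = Unique.map⁻ (subst Unique (sym gfxs≡xs) xs!)

    to : ∀ {y} → y ∈ₗ map f xs → y ∈ₗ ys
    to y∈ with x , x∈ , refl ← ∈-map⁻ f y∈ = f∈ x∈

    from : ∀ {y} → y ∈ₗ ys → y ∈ₗ map f xs
    from y∈ = subst (_∈ₗ map f xs) (fg≡id y∈) (∈-map⁺ f (g∈ y∈))

module _ {n : ℕ} where

  elements : Subset n → List (Fin n)
  elements s = filter (_∈? s) (allFin n)

  ∈-elements⁺ : ∀ {a s} → a ∈ s → a ∈ₗ elements s
  ∈-elements⁺ {a} {s} a∈s = ∈-filter⁺ (_∈? s) (∈-allFin a) a∈s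

  ∈-elements⁻ : ∀ {a s} → a ∈ₗ elements s → a ∈ s
  ∈-elements⁻ {s = s} = proj₂ ∘ ∈-filter⁻ (_∈? s) {xs = allFin n}

  elements-unique : ∀ s → Unique (elements s)
  elements-unique s = Unique.filter⁺ (_∈? s) (Unique.allFin⁺ n)

  elements-↭ : ∀ {s xs} → Unique xs
    → (∀ {a} → a ∈ s → a ∈ₗ xs) → (∀ {a} → a ∈ₗ xs → a ∈ s) → elements s ↭ xs
  elements-↭ {s} xs! ⊆xs xs⊆ =
    ∼bag⇒↭ (unique∧set⇒bag (elements-unique s) xs! (mk⇔ (⊆xs ∘ ∈-elements⁻) (∈-elements⁺ ∘ xs⊆)))

filter-∈?-∷-map-suc : ∀ {n} b (s : Subset n) xs →
                      filter (_∈? b ∷ s) (map suc xs) ≡ map suc (filter (_∈? s) xs)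
filter-∈?-∷-map-suc b s []       = refl
-- does (suc i ∈? b ∷ s) reduces to does (i ∈? s), so one with-abstraction splits both filters.
filter-∈?-∷-map-suc b s (i ∷ xs) with does (i ∈? s)
... | true  = cong (suc i ∷_) (filter-∈?-∷-map-suc b s xs)
... | false = filter-∈?-∷-map-suc b s xs

length-elements-∷ : ∀ {n} b (s : Subset n) →
                    length (filter (_∈? b ∷ s) (tabulate suc)) ≡ length (elements s)
length-elements-∷ {n} b s = begin
  length (filter (_∈? b ∷ s) (tabulate suc))
    ≡⟨ cong (length ∘ filter (_∈? b ∷ s)) (map-tabulate (λ i → i) suc) ⟨
  length (filter (_∈? b ∷ s) (map suc (allFin n)))
    ≡⟨ cong length (filter-∈?-∷-map-suc b s (allFin n)) ⟩
  length (map suc (elements s))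
    ≡⟨ length-map suc (elements s) ⟩
  length (elements s)
    ∎

∣∣≡length-elements : ∀ {n} (s : Subset n) → ∣ s ∣ ≡ length (elements s)
∣∣≡length-elements []            = refl
∣∣≡length-elements (inside  ∷ s) =
  cong ℕ.suc (trans (∣∣≡length-elements s) (sym (length-elements-∷ inside s)))
∣∣≡length-elements (outside ∷ s) =
  trans (∣∣≡length-elements s) (sym (length-elements-∷ outside s))

module _ {n : ℕ} where

  ∉⇒lookup≡outside : ∀ {a : Fin n} {s} → a ∉ s → lookup s a ≡ outside
  ∉⇒lookup≡outside {a} {s} a∉s with lookup s a in eq
  ... | true  = contradiction (lookup⇒[]= a s eq) a∉s
  ... | false = refl

  elements-insert : ∀ {a : Fin n} {s} → a ∉ s → elements (s [ a ]≔ inside) ↭ a ∷ elements s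
  elements-insert {a} {s} a∉s = elements-↭ (All.tabulate a≢ ∷ elements-unique s) ⊆ ⊇
    where
    a≢ : ∀ {b} → b ∈ₗ elements s → a ≢ b
    a≢ b∈ refl = a∉s (∈-elements⁻ b∈)

    ⊆ : ∀ {b} → b ∈ s [ a ]≔ inside → b ∈ₗ a ∷ elements s
    ⊆ {b} b∈ with b ≟ a
    ... | yes refl = here refl
    ... | no b≢a   = there (∈-elements⁺ (lookup⇒[]= b s (begin
      lookup s b                   ≡⟨ lookup∘update′ b≢a s inside ⟨
      lookup (s [ a ]≔ inside) b   ≡⟨ []=⇒lookup b∈ ⟩
      inside                       ∎)))

    ⊇ : ∀ {b} → b ∈ₗ a ∷ elements s → b ∈ s [ a ]≔ inside
    ⊇ (here refl) = []≔-updates s a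
    ⊇ {b} (there b∈) = []≔-minimal s b a (a≢ b∈ ∘ sym) (∈-elements⁻ b∈)

∣insert∣ : ∀ {n} {a : Fin n} {s} → a ∉ s → ∣ s [ a ]≔ inside ∣ ≡ ℕ.suc ∣ s ∣
∣insert∣ {a = a} {s} a∉s = begin
  ∣ s [ a ]≔ inside ∣                   ≡⟨ ∣∣≡length-elements (s [ a ]≔ inside) ⟩
  length (elements (s [ a ]≔ inside))   ≡⟨ ↭-length (elements-insert a∉s) ⟩
  ℕ.suc (length (elements s))           ≡⟨ cong ℕ.suc (∣∣≡length-elements s) ⟨
  ℕ.suc ∣ s ∣                           ∎

∈-allSubsets : ∀ {n} (s : Subset n) → s ∈ₗ allSubsets n
∈-allSubsets []                     = here refl
∈-allSubsets         (outside ∷ s) = ∈-++⁺ˡ (∈-map⁺ (outside ∷_) (∈-allSubsets s))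
∈-allSubsets {ℕ.suc n} (inside ∷ s) =
  ∈-++⁺ʳ (map (outside ∷_) (allSubsets n)) (∈-map⁺ (inside ∷_) (∈-allSubsets s))

allSubsets-unique : ∀ n → Unique (allSubsets n)
allSubsets-unique ℕ.zero    = [] ∷ []
allSubsets-unique (ℕ.suc n) =
  Unique.++⁺ (Unique.map⁺ ∷-injectiveʳ (allSubsets-unique n))
             (Unique.map⁺ ∷-injectiveʳ (allSubsets-unique n))
             outside≢inside
  where
  outside≢inside : ∀ {s} →
    ¬ (s ∈ₗ map (outside ∷_) (allSubsets n) × s ∈ₗ map (inside ∷_) (allSubsets n))
  outside≢inside (s∈ₒ , s∈ᵢ)
    with _ , _ , refl ← ∈-map⁻ (outside ∷_) s∈ₒ | _ , _ , () ← ∈-map⁻ (inside ∷_) s∈ᵢ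

module _ {n : ℕ} (G : FinAbelianGroup n) where
  open FinAbelianGroup G

  private
    abelianGroup : AbelianGroup 0ℓ 0ℓ
    abelianGroup = record { isAbelianGroup = isAbelianGroup }

  open AbelianGroup abelianGroup
    using (assoc; identityˡ; identityʳ; inverseˡ; inverseʳ; isCommutativeMonoid; commutativeSemigroup)
  open AbelianGroupProperties abelianGroup
    using (ε⁻¹≈ε; ⁻¹-∙-comm; ∙-cancelʳ; x≈z//y; //-rightDividesˡ; //-rightDividesʳ)
  open CommutativeSemigroupProperties commutativeSemigroup using (interchange)

  sum : List (Fin n) → Fin n
  sum = foldr _+_ 0g

  sum-↭ : ∀ {xs ys} → xs ↭ ys → sum xs ≡ sum ys
  sum-↭ = PermSetoid.foldr-commMonoid (setoid (Fin n)) isCommutativeMonoid ∘ ↭⇒↭ₛ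

  sum-map-+ : ∀ y xs → sum (map (_+ y) xs) ≡ sum xs + length xs · y
  sum-map-+ y []       = sym (identityʳ 0g)
  sum-map-+ y (a ∷ xs) = begin
    (a + y) + sum (map (_+ y) xs)       ≡⟨ cong ((a + y) +_) (sum-map-+ y xs) ⟩
    (a + y) + (sum xs + length xs · y)  ≡⟨ interchange a y (sum xs) (length xs · y) ⟩
    (a + sum xs) + (y + length xs · y)  ∎

  translate : Fin n → Subset n → Subset n
  translate y s = Vec.tabulate (λ a → lookup s (a - y))

  translate-+ : ∀ y z s → translate y (translate z s) ≡ translate (y + z) s
  translate-+ y z s = tabulate-cong λ a → begin
    lookup (translate z s) (a - y)  ≡⟨ lookup∘tabulate _ (a - y) ⟩
    lookup s ((a - y) - z)          ≡⟨ cong (lookup s) (assoc a (- y) (- z)) ⟩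
    lookup s (a + (- y + - z))      ≡⟨ cong (lookup s ∘ (a +_)) (⁻¹-∙-comm y z) ⟩
    lookup s (a - (y + z))          ∎

  translate-0g : ∀ s → translate 0g s ≡ s
  translate-0g s = trans (tabulate-cong a-0≡a) (tabulate∘lookup s)
    where
    a-0≡a : ∀ a → lookup s (a - 0g) ≡ lookup s a
    a-0≡a a = cong (lookup s) (trans (cong (a +_) ε⁻¹≈ε) (identityʳ a))

  translate-inverse : ∀ {y z} → y + z ≡ 0g → ∀ s → translate y (translate z s) ≡ s
  translate-inverse {y} {z} y+z≡0 s =
    trans (translate-+ y z s) (trans (cong (λ c → translate c s) y+z≡0) (translate-0g s))

  ∈-translate⁺ : ∀ {a y s} → a ∈ s → a + y ∈ translate y s
  ∈-translate⁺ {a} {y} {s} a∈s = lookup⇒[]= (a + y) (translate y s) (begin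
    lookup (translate y s) (a + y)  ≡⟨ lookup∘tabulate _ (a + y) ⟩
    lookup s ((a + y) - y)          ≡⟨ cong (lookup s) (//-rightDividesʳ y a) ⟩
    lookup s a                      ≡⟨ []=⇒lookup a∈s ⟩
    inside                          ∎)

  ∈-translate⁻ : ∀ {a y s} → a ∈ translate y s → a - y ∈ s
  ∈-translate⁻ {a} {y} {s} a∈ =
    lookup⇒[]= (a - y) s (trans (sym (lookup∘tabulate _ a)) ([]=⇒lookup a∈))

  elements-translate : ∀ y s → elements (translate y s) ↭ map (_+ y) (elements s)
  elements-translate y s =
    elements-↭ (Unique.map⁺ (∙-cancelʳ y _ _) (elements-unique s)) ⊆ ⊇
    where
    ⊆ : ∀ {a} → a ∈ translate y s → a ∈ₗ map (_+ y) (elements s)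
    ⊆ {a} a∈ = subst (_∈ₗ map (_+ y) (elements s)) (//-rightDividesˡ y a)
                     (∈-map⁺ (_+ y) (∈-elements⁺ (∈-translate⁻ a∈)))

    ⊇ : ∀ {a} → a ∈ₗ map (_+ y) (elements s) → a ∈ translate y s
    ⊇ a∈ with _ , b∈ , refl ← ∈-map⁻ (_+ y) a∈ = ∈-translate⁺ (∈-elements⁻ b∈)

  ∣translate∣ : ∀ y s → ∣ translate y s ∣ ≡ ∣ s ∣
  ∣translate∣ y s = begin
    ∣ translate y s ∣                   ≡⟨ ∣∣≡length-elements (translate y s) ⟩
    length (elements (translate y s))   ≡⟨ ↭-length (elements-translate y s) ⟩
    length (map (_+ y) (elements s))    ≡⟨ length-map (_+ y) (elements s) ⟩
    length (elements s)                 ≡⟨ ∣∣≡length-elements s ⟨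
    ∣ s ∣                               ∎

  Σ-translate : ∀ y s → Σ[ translate y s ] ≡ Σ[ s ] + ∣ s ∣ · y
  Σ-translate y s = begin
    sum (elements (translate y s))    ≡⟨ sum-↭ (elements-translate y s) ⟩
    sum (map (_+ y) (elements s))     ≡⟨ sum-map-+ y (elements s) ⟩
    Σ[ s ] + length (elements s) · y  ≡⟨ cong (λ m → Σ[ s ] + m · y) (∣∣≡length-elements s) ⟨
    Σ[ s ] + ∣ s ∣ · y                ∎

  Σ-insert : ∀ {a s} → a ∉ s → Σ[ s [ a ]≔ inside ] ≡ a + Σ[ s ]
  Σ-insert a∉s = sum-↭ (elements-insert a∉s)

  puncture : Fin n → Subset n → Subset n
  puncture y s = translate (- y) s [ 0g ]≔ outside

  unpuncture : Fin n → Subset n → Subset n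
  unpuncture y t = translate y (t [ 0g ]≔ inside)

  0∉puncture : ∀ y s → 0g ∉ puncture y s
  0∉puncture y s 0∈ with () ← []=-injective ([]≔-updates (translate (- y) s) 0g) 0∈

  y∈unpuncture : ∀ y t → y ∈ unpuncture y t
  y∈unpuncture y t = subst (_∈ unpuncture y t) (identityˡ y) (∈-translate⁺ ([]≔-updates t 0g))

  unpuncture-puncture : ∀ {y s} → y ∈ s → unpuncture y (puncture y s) ≡ s
  unpuncture-puncture {y} {s} y∈s = begin
    translate y ((u [ 0g ]≔ outside) [ 0g ]≔ inside)  ≡⟨ cong (translate y) ([]≔-idempotent u 0g) ⟩
    translate y (u [ 0g ]≔ inside)                    ≡⟨ cong (λ b → translate y (u [ 0g ]≔ b)) u₀≡inside ⟨
    translate y (u [ 0g ]≔ lookup u 0g)               ≡⟨ cong (translate y) ([]≔-lookup u 0g) ⟩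
    translate y (translate (- y) s)                   ≡⟨ translate-inverse (inverseʳ y) s ⟩
    s                                                 ∎
    where
    u = translate (- y) s
    u₀≡inside : lookup u 0g ≡ inside
    u₀≡inside = []=⇒lookup (subst (_∈ u) (inverseʳ y) (∈-translate⁺ y∈s))

  puncture-unpuncture : ∀ {y t} → 0g ∉ t → puncture y (unpuncture y t) ≡ t
  puncture-unpuncture {y} {t} 0∉t = begin
    translate (- y) (translate y v) [ 0g ]≔ outside  ≡⟨ cong (_[ 0g ]≔ outside) (translate-inverse (inverseˡ y) v) ⟩
    (t [ 0g ]≔ inside) [ 0g ]≔ outside               ≡⟨ []≔-idempotent t 0g ⟩
    t [ 0g ]≔ outside                                ≡⟨ cong (t [ 0g ]≔_) (∉⇒lookup≡outside 0∉t) ⟨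
    t [ 0g ]≔ lookup t 0g                            ≡⟨ []≔-lookup t 0g ⟩
    t                                                ∎
    where v = t [ 0g ]≔ inside

  ∣unpuncture∣ : ∀ y {t} → 0g ∉ t → ∣ unpuncture y t ∣ ≡ ℕ.suc ∣ t ∣
  ∣unpuncture∣ y {t} 0∉t = trans (∣translate∣ y (t [ 0g ]≔ inside)) (∣insert∣ 0∉t)

  Σ-unpuncture : ∀ y {t} → 0g ∉ t → Σ[ unpuncture y t ] ≡ Σ[ t ] + ℕ.suc ∣ t ∣ · y
  Σ-unpuncture y {t} 0∉t = begin
    Σ[ translate y v ]         ≡⟨ Σ-translate y v ⟩
    Σ[ v ] + ∣ v ∣ · y         ≡⟨ cong₂ (λ σ m → σ + m · y) (trans (Σ-insert 0∉t) (identityˡ Σ[ t ]))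
                                                            (∣insert∣ 0∉t) ⟩
    Σ[ t ] + ℕ.suc ∣ t ∣ · y   ∎
    where v = t [ 0g ]≔ inside

  ∣puncture∣ : ∀ {y s} → y ∈ s → ℕ.suc ∣ puncture y s ∣ ≡ ∣ s ∣
  ∣puncture∣ {y} {s} y∈s =
    trans (sym (∣unpuncture∣ y (0∉puncture y s))) (cong ∣_∣ (unpuncture-puncture y∈s))

  Σ-puncture : ∀ {y s} → y ∈ s → Σ[ puncture y s ] + ∣ s ∣ · y ≡ Σ[ s ]
  Σ-puncture {y} {s} y∈s = begin
    Σ[ t ] + ∣ s ∣ · y          ≡⟨ cong (λ m → Σ[ t ] + m · y) (∣puncture∣ y∈s) ⟨
    Σ[ t ] + ℕ.suc ∣ t ∣ · y    ≡⟨ Σ-unpuncture y (0∉puncture y s) ⟨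
    Σ[ unpuncture y t ]         ≡⟨ cong Σ[_] (unpuncture-puncture y∈s) ⟩
    Σ[ s ]                      ∎
    where t = puncture y s

  ∈-𝓑⁻ : ∀ {k x s} → s ∈ₗ 𝓑 G k x → ∣ s ∣ ≡ k × Σ[ s ] ≡ x
  ∈-𝓑⁻ = proj₂ ∘ ∈-filter⁻ _ {xs = allSubsets n}

  ∈-𝓑⁺ : ∀ {k x s} → ∣ s ∣ ≡ k → Σ[ s ] ≡ x → s ∈ₗ 𝓑 G k x
  ∈-𝓑⁺ {s = s} ∣s∣≡k Σs≡x = ∈-filter⁺ _ (∈-allSubsets s) (∣s∣≡k , Σs≡x)

  ∈-𝓑*⁻ : ∀ {k x t} → t ∈ₗ 𝓑* G k x → 0g ∉ t × ∣ t ∣ ≡ k × Σ[ t ] ≡ x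
  ∈-𝓑*⁻ = proj₂ ∘ ∈-filter⁻ _ {xs = allSubsets n}

  ∈-𝓑*⁺ : ∀ {k x t} → 0g ∉ t → ∣ t ∣ ≡ k → Σ[ t ] ≡ x → t ∈ₗ 𝓑* G k x
  ∈-𝓑*⁺ {t = t} 0∉t ∣t∣≡k Σt≡x = ∈-filter⁺ _ (∈-allSubsets t) (0∉t , ∣t∣≡k , Σt≡x)

  𝓑-unique : ∀ k x → Unique (𝓑 G k x)
  𝓑-unique k x = Unique.filter⁺ _ (allSubsets-unique n)

  𝓑*-unique : ∀ k x → Unique (𝓑* G k x)
  𝓑*-unique k x = Unique.filter⁺ _ (allSubsets-unique n)

  𝓑-uniform : ∀ k x → All (λ s → ∣ s ∣ ≡ k) (𝓑 G k x)
  𝓑-uniform k x = All.tabulate (proj₁ ∘ ∈-𝓑⁻)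

  module _ (k : ℕ) (x y : Fin n) where

    private
      K = ℕ.suc k

    puncture-∈𝓑* : ∀ {s} → s ∈ₗ filter (y ∈?_) (𝓑 G K x) → puncture y s ∈ₗ 𝓑* G k (x - (K · y))
    puncture-∈𝓑* {s} s∈
      with s∈𝓑 , y∈s ← ∈-filter⁻ (y ∈?_) s∈
      with ∣s∣≡K , Σs≡x ← ∈-𝓑⁻ s∈𝓑
      = ∈-𝓑*⁺ (0∉puncture y s) (suc-injective (trans (∣puncture∣ y∈s) ∣s∣≡K))
              (x≈z//y Σ[ puncture y s ] (K · y) x (begin
                Σ[ puncture y s ] + K · y      ≡⟨ cong (λ m → Σ[ puncture y s ] + m · y) ∣s∣≡K ⟨
                Σ[ puncture y s ] + ∣ s ∣ · y  ≡⟨ Σ-puncture y∈s ⟩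
                Σ[ s ]                         ≡⟨ Σs≡x ⟩
                x                              ∎))

    unpuncture-∈𝓑 : ∀ {t} → t ∈ₗ 𝓑* G k (x - (K · y)) → unpuncture y t ∈ₗ filter (y ∈?_) (𝓑 G K x)
    unpuncture-∈𝓑 {t} t∈
      with 0∉t , ∣t∣≡k , Σt≡x-Ky ← ∈-𝓑*⁻ t∈
      = ∈-filter⁺ (y ∈?_) (∈-𝓑⁺ (trans (∣unpuncture∣ y 0∉t) (cong ℕ.suc ∣t∣≡k)) (begin
          Σ[ unpuncture y t ]       ≡⟨ Σ-unpuncture y 0∉t ⟩
          Σ[ t ] + ℕ.suc ∣ t ∣ · y  ≡⟨ cong₂ (λ σ m → σ + ℕ.suc m · y) Σt≡x-Ky ∣t∣≡k ⟩
          (x - (K · y)) + K · y     ≡⟨ //-rightDividesˡ (K · y) x ⟩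
          x                         ∎))
        (y∈unpuncture y t)

    blocks-through≡b* : length (filter (y ∈?_) (𝓑 G K x)) ≡ b* G k (x - (K · y))
    blocks-through≡b* = length-≡-by-inverses
      (Unique.filter⁺ (y ∈?_) (𝓑-unique K x)) (𝓑*-unique k (x - (K · y)))
      (puncture y) (unpuncture y) puncture-∈𝓑* unpuncture-∈𝓑
      (unpuncture-puncture ∘ proj₂ ∘ ∈-filter⁻ (y ∈?_) {xs = 𝓑 G K x})
      (puncture-unpuncture ∘ proj₁ ∘ ∈-𝓑*⁻)

lemma1 : ∀ {n : ℕ} (G : FinAbelianGroup n) (x : Fin n) (k : ℕ) → 2 ≤ k
    → 𝓑 G k x ≢ [] → (r : ℕ)
    → Is1Design n k r (𝓑 G k x)
      ⇔ (∀ (y : Fin n) → b* G (k ∸ 1) (FinAbelianGroup._-_ G x (FinAbelianGroup._·_ G k y)) ≡ r)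
lemma1 G x (ℕ.suc k) _ _ r = mk⇔
  (λ (_ , _ , through≡r) y → trans (sym (blocks-through≡b* G k x y)) (through≡r y))
  (λ b*≡r → 𝓑-unique G (ℕ.suc k) x , 𝓑-uniform G (ℕ.suc k) x
          , λ y → trans (blocks-through≡b* G k x y) (b*≡r y))
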